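{- Let $f : A \to C$ and $g : B \to C$ be maps of event structures and $A \circledast B$ their pullback with projections $\Pi_1, \Pi_2$. Let $x \in \mathscr{C}(A \circledast B)$ and let $p = [(a,b)]_y$ and $p' = [(a',b')]_{y'}$ be events of $A\circledast B$ not in $x$ such that $x \cup \{p\} \in \mathscr{C}(A\circledast B)$ and $x \cup \{p'\} \in \mathscr{C}(A\circledast B)$, but $x \cup \{p, p'\} \notin \mathscr{C}(A \circledast B)$. Then either $\Pi_1(x) \cup \{a, a'\} \notin \mathscr{C}(A)$, or $\Pi_2(x) \cup \{b,b'\} \notin \mathscr{C}(B)$.
   Context: Event structures $(E,\leq,\mathrm{Con})$: $\leq$ a partial order with finite down-sets, $\mathrm{Con}$ a nonempty family of finite sets containing singletons, closed under subsets, with $X\in\mathrm{Con}$, $e\leq e'\in X \Rightarrow X\cup\{e\}\in\mathrm{Con}$. Configurations $\mathscr{C}(E)$: finite consistent down-closed subsets. Maps of event structures preserve configurations and are injective on configurations. Pullback: for $f : A\to C$, $g: B\to C$, a set $x\subseteq A\times B$ is a configuration of the product stable family if its projections are configurations of $A$ and $B$, the projections are injective on $x$, and for distinct $e,e'\in x$ there is $y\subseteq x$ with both projections configurations and $e\in y\Leftrightarrow e'\notin y$. Let $\mathcal{F}$ be the set of such $x$ contained in $R=\{(a,b)\mid f(a)=g(b)\}$. For $x\in\mathcal{F}$, $e\leq_x e'$ iff every $y\in\mathcal{F}$ with $y\subseteq x$, $e'\in y$ contains $e$; $[e]_x=\{e'\in x\mid e'\leq_x e\}$. $A\circledast B$ has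 events the primes $[e]_x$, order inclusion, and $X$ consistent iff $\bigcup X\in\mathcal{F}$; projections $\Pi_1([(a,b)]_x)=a$, $\Pi_2([(a,b)]_x)=b$, applied elementwise to configurations. -}

module Defs where

open import Level using (0ℓ)
open import Data.Product using (Σ; ∃; ∃-syntax; _×_; _,_; proj₁; proj₂)
open import Data.List using (List; []; _∷_; map)
open import Data.List.Membership.Propositional using (_∈_)
open import Data.List.Relation.Binary.Subset.Propositional using (_⊆_)
open import Data.List.Relation.Unary.Any using (Any)
open import Relation.Binary.PropositionalEquality using (_≡_; _≢_)
open import Relation.Binary.Structures using (IsPartialOrder)
open import Relation.Nullary using (¬_)
open import Function.Bundles using (_⇔_)

-- Finite subsets are represented by lists (membership via _∈_ = Any _≡_);
-- all notions below only depend on the membership relation of the lists.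

record EventStructure : Set₁ where
  field
    E      : Set
    _≤_    : E → E → Set
    isPO   : IsPartialOrder _≡_ _≤_
    finDown : ∀ e → ∃[ xs ] (∀ e' → (e' ≤ e) ⇔ (e' ∈ xs))
    Con    : List E → Set
    Con-nonempty : ∃[ X ] Con X
    Con-sing : ∀ e → Con (e ∷ [])
    Con-sub  : ∀ {X Y} → X ⊆ Y → Con Y → Con X
    Con-down : ∀ {X e e'} → Con X → e ≤ e' → e' ∈ X → Con (e ∷ X)

  DownClosed : List E → Set
  DownClosed x = ∀ {e e'} → e' ∈ x → e ≤ e' → e ∈ x

  Config : List E → Set
  Config x = Con x × DownClosed x

open EventStructure public using (E; Config)

record Map (A B : EventStructure) : Set where
  field
    fun       : E A → E B
    preserves : ∀ {x} → Config A x → Config B (map fun x)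
    injective : ∀ {x} → Config A x → ∀ {a a'} → a ∈ x → a' ∈ x →
                fun a ≡ fun a' → a ≡ a'

open Map public using (fun)

module Pullback {A B C : EventStructure} (f : Map A C) (g : Map B C) where

  P : Set
  P = E A × E B

  π₁ : List P → List (E A)
  π₁ = map proj₁

  π₂ : List P → List (E B)
  π₂ = map proj₂

  -- configurations of the product stable family
  ProdConfig : List P → Set
  ProdConfig x =
    Config A (π₁ x) × Config B (π₂ x)
    × (∀ {e e'} → e ∈ x → e' ∈ x → proj₁ e ≡ proj₁ e' → e ≡ e')
    × (∀ {e e'} → e ∈ x → e' ∈ x → proj₂ e ≡ proj₂ e' → e ≡ e')
    × (∀ {e e'} → e ∈ x → e' ∈ x → e ≢ e' →
         ∃[ y ] (y ⊆ x × Config A (π₁ y) × Config B (π₂ y)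
                 × ((e ∈ y) ⇔ (¬ (e' ∈ y)))))

  InR : List P → Set
  InR x = ∀ {e} → e ∈ x → fun f (proj₁ e) ≡ fun g (proj₂ e)

  𝓕 : List P → Set
  𝓕 x = ProdConfig x × InR x

  _≤[_]_ : P → List P → P → Set
  e ≤[ x ] e' = ∀ y → 𝓕 y → y ⊆ x → e' ∈ y → e ∈ y

  -- an event of A ⊛ B: the prime [e]_x, given by x ∈ 𝓕 and e ∈ x
  record Ev : Set where
    constructor [_]_⟨_,_⟩
    field
      top  : P
      conf : List P
      conf∈𝓕 : 𝓕 conf
      top∈ : top ∈ conf

  _∈ₚ_ : P → Ev → Set
  c ∈ₚ p = c ∈ Ev.conf p × c ≤[ Ev.conf p ] Ev.top p

  -- events are sets: equality is extensional equality, order is inclusion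
  _≈ₑ_ : Ev → Ev → Set
  p ≈ₑ q = ∀ c → (c ∈ₚ p) ⇔ (c ∈ₚ q)

  _⊑_ : Ev → Ev → Set
  p ⊑ q = ∀ c → c ∈ₚ p → c ∈ₚ q

  _∈ₑ_ : Ev → List Ev → Set
  p ∈ₑ X = Any (p ≈ₑ_) X

  -- X consistent iff ⋃X ∈ 𝓕 (⋃X enumerated by some list z)
  Consistent : List Ev → Set
  Consistent X = ∃[ z ] ((∀ c → (c ∈ z) ⇔ (∃[ q ] (q ∈ₑ X × c ∈ₚ q))) × 𝓕 z)

  DownClosed⊛ : List Ev → Set
  DownClosed⊛ X = ∀ {q} → q ∈ₑ X → ∀ p → p ⊑ q → p ∈ₑ X

  Config⊛ : List Ev → Set
  Config⊛ X = Consistent X × DownClosed⊛ X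

  Π₁ : List Ev → List (E A)
  Π₁ = map (λ p → proj₁ (Ev.top p))

  Π₂ : List Ev → List (E B)
  Π₂ = map (λ p → proj₂ (Ev.top p))

-- Suppose both Π₁(x) ∪ {a, a'} and Π₂(x) ∪ {b, b'} are configurations, and let z₁, z₂ ∈ 𝓕
-- be the unions of x ∪ {p} and x ∪ {p'}.  Every element of such a union is the top of an
-- event of the configuration, because a prime [c]_w determines c (tops are unique by
-- antisymmetry of ≤_w, which needs the restriction of a member of 𝓕 to a subset with
-- configuration projections to stay in 𝓕).  Hence the projections of z₁ ∪ z₂ are
-- consistent, so z₁ ∪ z₂ ∈ 𝓕 (separation: within z₁ or z₂, or by z₁ itself), and it
-- exhibits x ∪ {p, p'} as a configuration.  Equality and membership on finite sets are
-- only decidable under double negation, whence the double-negated conclusion.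
module Submission where

open import Defs
open import Level using (0ℓ)
open import Function using (_∘_)
open import Function.Bundles using (_⇔_; mk⇔; Equivalence)
open import Data.Empty using (⊥-elim)
open import Data.Product using (_×_; _,_; proj₁; proj₂; ∃-syntax; map₁)
open import Data.Sum using (_⊎_; inj₁; inj₂; [_,_]′)
open import Data.List using (List; []; _∷_; map; _++_)
open import Data.List.Properties using (map-++; map-∘)
open import Data.List.Relation.Unary.Any using (here; there)
import Data.List.Relation.Unary.Any.Properties as Any
import Data.List.Relation.Unary.All as All
open import Data.List.Membership.Propositional using (_∈_; find)
open import Data.List.Membership.Propositional.Properties
  using (∈-map⁺; ∈-map⁻; ∈-++⁺ˡ; ∈-++⁺ʳ; ∈-++⁻)
open import Data.List.Relation.Binary.Subset.Propositional using (_⊆_)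
open import Data.List.Relation.Binary.Subset.Propositional.Properties
  using (map⁺; Any-resp-⊆; xs⊆x∷xs; ∷⁺ʳ)
open import Relation.Nullary using (¬_; Dec; yes; no)
open import Relation.Nullary.Decidable using (¬¬-excluded-middle)
open import Relation.Nullary.Negation using (¬¬-Monad)
open import Relation.Binary.PropositionalEquality using (_≡_; _≢_; refl; sym; trans; cong; subst)
open import Effect.Monad using (RawMonad)

open RawMonad (¬¬-Monad {a = 0ℓ})
open Equivalence using (to; from)
open EventStructure using (Con; Con-sub; DownClosed)

Intersection : {T : Set} → List T → List T → List T → Set
Intersection i y y' = ∀ {d} → d ∈ i ⇔ (d ∈ y × d ∈ y')

module _ {T : Set} where

  DecidableOn : List T → (T → Set) → Set
  DecidableOn v Q = ∀ {d} → d ∈ v → Dec (Q d)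

  DecEqOn : List T → Set
  DecEqOn v = ∀ {d} → d ∈ v → DecidableOn v (d ≡_)

  InjectiveOn : {U : Set} → (T → U) → List T → Set
  InjectiveOn h v = ∀ {d d'} → d ∈ v → d' ∈ v → h d ≡ h d' → d ≡ d'

  ¬¬-∀∈ : {Q : T → Set} (v : List T) →
    (∀ {d} → d ∈ v → ¬ ¬ Q d) → ¬ ¬ (∀ {d} → d ∈ v → Q d)
  ¬¬-∀∈ v h = All.lookup <$> All.sequenceA 0ℓ rawApplicative (All.tabulate h)

  ¬¬-decidableOn : {Q : T → Set} (v : List T) → ¬ ¬ DecidableOn v Q
  ¬¬-decidableOn v = ¬¬-∀∈ v (λ _ → ¬¬-excluded-middle)

  ¬¬-decEqOn : (v : List T) → ¬ ¬ DecEqOn v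
  ¬¬-decEqOn v = ¬¬-∀∈ v (λ _ → ¬¬-decidableOn v)

  ∈-decidableOn : ∀ {v y} → DecEqOn v → y ⊆ v → DecidableOn v (_∈ y)
  ∈-decidableOn {y = []} _ _ _ = no λ ()
  ∈-decidableOn {y = e ∷ y} deq y⊆v d∈v
    with deq d∈v (y⊆v (here refl)) | ∈-decidableOn deq (y⊆v ∘ there) d∈v
  ... | yes d≡e | _        = yes (here d≡e)
  ... | no _    | yes d∈y  = yes (there d∈y)
  ... | no d≢e  | no d∉y   = no λ { (here d≡e) → d≢e d≡e ; (there d∈y) → d∉y d∈y }

  separate : {Q : T → Set} (v : List T) → DecidableOn v Q →
    ∃[ S ] (∀ {d} → d ∈ S ⇔ (d ∈ v × Q d))
  separate [] _ = [] , mk⇔ (λ ()) (λ ())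
  separate (e ∷ v) Q? with separate v (Q? ∘ there) | Q? (here refl)
  ... | S , S⇔ | yes Qe = e ∷ S , mk⇔
        (λ { (here refl) → here refl , Qe ; (there d∈S) → map₁ there (to S⇔ d∈S) })
        (λ { (here refl , _) → here refl ; (there d∈v , Qd) → there (from S⇔ (d∈v , Qd)) })
  ... | S , S⇔ | no ¬Qe = S , mk⇔
        (map₁ there ∘ to S⇔)
        (λ { (here refl , Qe) → ⊥-elim (¬Qe Qe) ; (there d∈v , Qd) → from S⇔ (d∈v , Qd) })

  intersection : ∀ {v y y'} → DecEqOn v → y ⊆ v → y' ⊆ v → ∃[ i ] Intersection i y y'
  intersection {y = y} deq y⊆v y'⊆v = separate y (∈-decidableOn deq y'⊆v ∘ y⊆v)

  map-Intersection : {U : Set} (h : T → U) {v y y' i : List T} → InjectiveOn h v →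
    y ⊆ v → y' ⊆ v → Intersection i y y' → Intersection (map h i) (map h y) (map h y')
  map-Intersection h inj y⊆v y'⊆v i⇔ = mk⇔
    (λ e∈hi → let d , d∈i , e≡hd = ∈-map⁻ h e∈hi
                  d∈y , d∈y' = to i⇔ d∈i
              in subst (_∈ _) (sym e≡hd) (∈-map⁺ h d∈y) , subst (_∈ _) (sym e≡hd) (∈-map⁺ h d∈y'))
    (λ (e∈hy , e∈hy') →
       let d , d∈y , e≡hd = ∈-map⁻ h e∈hy
           d' , d'∈y' , e≡hd' = ∈-map⁻ h e∈hy'
           d≡d' = inj (y⊆v d∈y) (y'⊆v d'∈y') (trans (sym e≡hd) e≡hd')
       in subst (_∈ _) (sym e≡hd) (∈-map⁺ h (from i⇔ (d∈y , subst (_∈ _) (sym d≡d') d'∈y'))))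

module _ (X : EventStructure) where

  Config-∩ : ∀ {w u u'} → Intersection w u u' → Config X u → Config X u' → Config X w
  Config-∩ w⇔ (conᵤ , downᵤ) (_ , downᵤ') =
    Con-sub X (proj₁ ∘ to w⇔) conᵤ ,
    λ e'∈w e≤e' → let e'∈u , e'∈u' = to w⇔ e'∈w in from w⇔ (downᵤ e'∈u e≤e' , downᵤ' e'∈u' e≤e')

  DownClosed-++ : ∀ {u u'} → DownClosed X u → DownClosed X u' → DownClosed X (u ++ u')
  DownClosed-++ {u} down down' e'∈ e≤e' =
    [ (λ e'∈u → ∈-++⁺ˡ (down e'∈u e≤e')) , (λ e'∈u' → ∈-++⁺ʳ u (down' e'∈u' e≤e')) ]′ (∈-++⁻ u e'∈)

module _ {A B C : EventStructure} (f : Map A C) (g : Map B C) where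
  open Pullback f g

  π₁-config : ∀ {v} → 𝓕 v → Config A (π₁ v)
  π₁-config ((cA , _) , _) = cA

  π₂-config : ∀ {v} → 𝓕 v → Config B (π₂ v)
  π₂-config ((_ , cB , _) , _) = cB

  proj₁-injectiveOn : ∀ {v} → 𝓕 v → InjectiveOn proj₁ v
  proj₁-injectiveOn ((_ , _ , inj , _) , _) = inj

  proj₂-injectiveOn : ∀ {v} → 𝓕 v → InjectiveOn proj₂ v
  proj₂-injectiveOn ((_ , _ , _ , inj , _) , _) = inj

  Separating : List P → P → P → Set
  Separating v e e' = ∃[ y ] (y ⊆ v × Config A (π₁ y) × Config B (π₂ y) × ((e ∈ y) ⇔ (¬ (e' ∈ y))))

  separating : ∀ {v e e'} → 𝓕 v → e ∈ v → e' ∈ v → e ≢ e' → Separating v e e'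
  separating ((_ , _ , _ , _ , sep) , _) = sep

  Separating-⊆ : ∀ {v w e e'} → v ⊆ w → Separating v e e' → Separating w e e'
  Separating-⊆ v⊆w (y , y⊆v , rest) = y , v⊆w ∘ y⊆v , rest

  proj₁-injective-InR : ∀ {z} → InR z → Config B (π₂ z) → InjectiveOn proj₁ z
  proj₁-injective-InR r cB {a , _} d∈z d'∈z refl = cong (a ,_)
    (Map.injective g cB (∈-map⁺ proj₂ d∈z) (∈-map⁺ proj₂ d'∈z) (trans (sym (r d∈z)) (r d'∈z)))

  proj₂-injective-InR : ∀ {z} → InR z → Config A (π₁ z) → InjectiveOn proj₂ z
  proj₂-injective-InR r cA {_ , b} d∈z d'∈z refl = cong (_, b)
    (Map.injective f cA (∈-map⁺ proj₁ d∈z) (∈-map⁺ proj₁ d'∈z) (trans (r d∈z) (sym (r d'∈z))))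

  ≤[]-refl : ∀ {v e} → e ≤[ v ] e
  ≤[]-refl _ _ _ e∈y = e∈y

  ≤[]-trans : ∀ {v d e c} → d ≤[ v ] e → e ≤[ v ] c → d ≤[ v ] c
  ≤[]-trans d≤e e≤c y Fy y⊆v = d≤e y Fy y⊆v ∘ e≤c y Fy y⊆v

  module Side (X : EventStructure) (pr : P → E X)
              (config : ∀ {v} → 𝓕 v → Config X (map pr v))
              (injectiveOn : ∀ {v} → 𝓕 v → InjectiveOn pr v) where
    open EventStructure X using () renaming (_≤_ to _≤ₓ_)

    ∩-config : ∀ {v y y' i} → 𝓕 v → y ⊆ v → y' ⊆ v → Intersection i y y' →
      Config X (map pr y) → Config X (map pr y') → Config X (map pr i)
    ∩-config Fv y⊆v y'⊆v i⇔ =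
      Config-∩ X (map-Intersection pr (injectiveOn Fv) y⊆v y'⊆v i⇔)

    ≤-reflects : ∀ {v d d'} → 𝓕 v → d' ∈ v → pr d' ≤ₓ pr d → d' ≤[ v ] d
    ≤-reflects Fv d'∈v d'≤d y Fy y⊆v d∈y =
      let d'' , d''∈y , prd'≡prd'' = ∈-map⁻ pr (proj₂ (config Fy) (∈-map⁺ pr d∈y) d'≤d)
      in subst (_∈ y) (sym (injectiveOn Fv d'∈v (y⊆v d''∈y) prd'≡prd'')) d''∈y

    prime-config : ∀ {v c S} → 𝓕 v → (∀ {d} → d ∈ S ⇔ (d ∈ v × d ≤[ v ] c)) →
      Config X (map pr S)
    prime-config {S = S} Fv S⇔ =
      Con-sub X (map⁺ pr (proj₁ ∘ to S⇔)) (proj₁ (config Fv)) , down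
      where
      down : DownClosed X (map pr S)
      down {e} e'∈ e≤e' =
        let d , d∈S , e'≡prd = ∈-map⁻ pr e'∈
            d∈v , d≤c = to S⇔ d∈S
            e≤prd = subst (e ≤ₓ_) e'≡prd e≤e'
            d' , d'∈v , e≡prd' = ∈-map⁻ pr (proj₂ (config Fv) (∈-map⁺ pr d∈v) e≤prd)
            d'≤d = ≤-reflects Fv d'∈v (subst (_≤ₓ pr d) e≡prd' e≤prd)
        in subst (_∈ _) (sym e≡prd') (∈-map⁺ pr (from S⇔ (d'∈v , ≤[]-trans d'≤d d≤c)))

  module Side₁ = Side A proj₁ π₁-config proj₁-injectiveOn
  module Side₂ = Side B proj₂ π₂-config proj₂-injectiveOn

  𝓕-restrict : ∀ {v y} → 𝓕 v → DecEqOn v → y ⊆ v → Config A (π₁ y) → Config B (π₂ y) → 𝓕 y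
  𝓕-restrict {y = y} Fv@(_ , r) deq y⊆v cA cB =
    (cA , cB , (λ d∈y d'∈y → proj₁-injectiveOn Fv (y⊆v d∈y) (y⊆v d'∈y)) ,
     (λ d∈y d'∈y → proj₂-injectiveOn Fv (y⊆v d∈y) (y⊆v d'∈y)) , sep) ,
    r ∘ y⊆v
    where
    sep : ∀ {e e'} → e ∈ y → e' ∈ y → e ≢ e' → Separating y e e'
    sep e∈y e'∈y e≢e' =
      let y' , y'⊆v , cA' , cB' , e∈y'⇔ = separating Fv (y⊆v e∈y) (y⊆v e'∈y) e≢e'
          i , i⇔ = intersection deq y⊆v y'⊆v
      in i , proj₁ ∘ to i⇔ ,
         Side₁.∩-config Fv y⊆v y'⊆v i⇔ cA cA' , Side₂.∩-config Fv y⊆v y'⊆v i⇔ cB cB' ,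
         mk⇔ (λ e∈i e'∈i → to e∈y'⇔ (proj₂ (to i⇔ e∈i)) (proj₂ (to i⇔ e'∈i)))
             (λ e'∉i → from i⇔ (e∈y , from e∈y'⇔ (λ e'∈y' → e'∉i (from i⇔ (e'∈y , e'∈y')))))

  prime-𝓕 : ∀ {v c S} → 𝓕 v → DecEqOn v → (∀ {d} → d ∈ S ⇔ (d ∈ v × d ≤[ v ] c)) → 𝓕 S
  prime-𝓕 Fv deq S⇔ =
    𝓕-restrict Fv deq (proj₁ ∘ to S⇔) (Side₁.prime-config Fv S⇔) (Side₂.prime-config Fv S⇔)

  ≤[]-antisym : ∀ {v c t} → 𝓕 v → DecEqOn v → c ∈ v → t ∈ v →
    c ≤[ v ] t → t ≤[ v ] c → c ≡ t
  ≤[]-antisym {t = t} Fv deq c∈v t∈v c≤t t≤c with deq c∈v t∈v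
  ... | yes c≡t = c≡t
  ... | no c≢t =
    let y , y⊆v , cA , cB , c∈y⇔ = separating Fv c∈v t∈v c≢t
        Fy = 𝓕-restrict Fv deq y⊆v cA cB
        t∉y : ¬ (t ∈ y)
        t∉y t∈y = to c∈y⇔ (c≤t y Fy y⊆v t∈y) t∈y
    in ⊥-elim (t∉y (t≤c y Fy y⊆v (from c∈y⇔ t∉y)))

  prime-top : ∀ {c w} (Fw : 𝓕 w) (c∈w : c ∈ w) (s : Ev) →
    [ c ] w ⟨ Fw , c∈w ⟩ ≈ₑ s → ¬ ¬ (c ≡ Ev.top s)
  prime-top {c} {w} Fw c∈w ([ t ] v ⟨ Fv , t∈v ⟩) c≈s = do
    deq ← ¬¬-decEqOn v
    ≤c? ← ¬¬-decidableOn v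
    let S , S⇔ = separate v ≤c?
        c∈v , c≤t = to (c≈s c) (c∈w , ≤[]-refl)
        _ , t≤c = from (c≈s t) (t∈v , ≤[]-refl)
        S⊆w : S ⊆ w
        S⊆w d∈S = let d∈v , d≤c = to S⇔ d∈S in proj₁ (from (c≈s _) (d∈v , ≤[]-trans d≤c c≤t))
        t∈S = t≤c S (prime-𝓕 Fv deq S⇔) S⊆w (from S⇔ (c∈v , ≤[]-refl))
    pure (≤[]-antisym Fv deq c∈v t∈v c≤t (proj₂ (to S⇔ t∈S)))

  Enumerates : List P → List Ev → Set
  Enumerates z X = ∀ c → (c ∈ z) ⇔ (∃[ q ] (q ∈ₑ X × c ∈ₚ q))

  ⋃⊆tops : ∀ {X} (H : Config⊛ X) → ¬ ¬ (proj₁ (proj₁ H) ⊆ map Ev.top X)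
  ⋃⊆tops ((z , z⇔ , _) , down) = ¬¬-∀∈ z λ {c} c∈z → do
    let q , q∈X , c∈conf , c≤top = to (z⇔ c) c∈z
        prime = [ c ] Ev.conf q ⟨ Ev.conf∈𝓕 q , c∈conf ⟩
        prime⊑q = λ d (d∈conf , d≤c) → d∈conf , ≤[]-trans d≤c c≤top
        s , s∈X , prime≈s = find (down {q} q∈X prime prime⊑q)
    c≡top ← prime-top (Ev.conf∈𝓕 q) c∈conf s prime≈s
    pure (subst (_∈ _) (sym c≡top) (∈-map⁺ Ev.top s∈X))

  𝓕-++ : ∀ {z₁ z₂} → 𝓕 z₁ → 𝓕 z₂ → Con A (π₁ (z₁ ++ z₂)) → Con B (π₂ (z₁ ++ z₂)) →
    DecidableOn z₂ (_∈ z₁) → 𝓕 (z₁ ++ z₂)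
  𝓕-++ {z₁} {z₂} F₁@(_ , r₁) F₂@(_ , r₂) conA conB ∈z₁? =
    (cA , cB , proj₁-injective-InR r cB , proj₂-injective-InR r cA , sep) , r
    where
    r : InR (z₁ ++ z₂)
    r = [ r₁ , r₂ ]′ ∘ ∈-++⁻ z₁
    cA : Config A (π₁ (z₁ ++ z₂))
    cA = conA , subst (DownClosed A) (sym (map-++ proj₁ z₁ z₂))
                  (DownClosed-++ A (proj₂ (π₁-config F₁)) (proj₂ (π₁-config F₂)))
    cB : Config B (π₂ (z₁ ++ z₂))
    cB = conB , subst (DownClosed B) (sym (map-++ proj₂ z₁ z₂))
                  (DownClosed-++ B (proj₂ (π₂-config F₁)) (proj₂ (π₂-config F₂)))
    by-z₁ : ∀ {e e'} → e ∈ z₁ → e' ∈ z₁ → e ≢ e' → Separating (z₁ ++ z₂) e e'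
    by-z₁ e∈ e'∈ e≢e' = Separating-⊆ ∈-++⁺ˡ (separating F₁ e∈ e'∈ e≢e')
    -- an element of z₂ outside z₁ is separated from one inside by z₁ itself
    by-whole-z₁ : ∀ {e e'} → (e ∈ z₁) ⇔ (¬ (e' ∈ z₁)) → Separating (z₁ ++ z₂) e e'
    by-whole-z₁ e∈⇔ = z₁ , ∈-++⁺ˡ , π₁-config F₁ , π₂-config F₁ , e∈⇔
    sep : ∀ {e e'} → e ∈ z₁ ++ z₂ → e' ∈ z₁ ++ z₂ → e ≢ e' → Separating (z₁ ++ z₂) e e'
    sep e∈ e'∈ e≢e' with ∈-++⁻ z₁ e∈ | ∈-++⁻ z₁ e'∈
    ... | inj₁ e∈₁ | inj₁ e'∈₁ = by-z₁ e∈₁ e'∈₁ e≢e'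
    ... | inj₂ e∈₂ | inj₂ e'∈₂ = Separating-⊆ (∈-++⁺ʳ z₁) (separating F₂ e∈₂ e'∈₂ e≢e')
    ... | inj₁ e∈₁ | inj₂ e'∈₂ with ∈z₁? e'∈₂
    ...   | yes e'∈₁ = by-z₁ e∈₁ e'∈₁ e≢e'
    ...   | no e'∉₁  = by-whole-z₁ (mk⇔ (λ _ → e'∉₁) (λ _ → e∈₁))
    sep e∈ e'∈ e≢e' | inj₂ e∈₂ | inj₁ e'∈₁ with ∈z₁? e∈₂
    ...   | yes e∈₁ = by-z₁ e∈₁ e'∈₁ e≢e'
    ...   | no e∉₁  = by-whole-z₁ (mk⇔ (⊥-elim ∘ e∉₁) (λ e'∉₁ → ⊥-elim (e'∉₁ e'∈₁)))

  Enumerates-union : ∀ {z₁ z₂ X₁ X₂ L} → X₁ ⊆ L → X₂ ⊆ L → L ⊆ X₁ ++ X₂ →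
    Enumerates z₁ X₁ → Enumerates z₂ X₂ → Enumerates (z₁ ++ z₂) L
  Enumerates-union {z₁} {X₁ = X₁} X₁⊆L X₂⊆L L⊆X z₁⇔ z₂⇔ c = mk⇔
    ([ (λ c∈z₁ → let q , q∈X₁ , c∈q = to (z₁⇔ c) c∈z₁ in q , Any-resp-⊆ X₁⊆L q∈X₁ , c∈q)
     , (λ c∈z₂ → let q , q∈X₂ , c∈q = to (z₂⇔ c) c∈z₂ in q , Any-resp-⊆ X₂⊆L q∈X₂ , c∈q)
     ]′ ∘ ∈-++⁻ z₁)
    (λ (q , q∈L , c∈q) →
       [ (λ q∈X₁ → ∈-++⁺ˡ (from (z₁⇔ c) (q , q∈X₁ , c∈q)))
       , (λ q∈X₂ → ∈-++⁺ʳ z₁ (from (z₂⇔ c) (q , q∈X₂ , c∈q)))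
       ]′ (Any.++⁻ X₁ (Any-resp-⊆ L⊆X q∈L)))

  DownClosed⊛-union : ∀ {X₁ X₂ L} → X₁ ⊆ L → X₂ ⊆ L → L ⊆ X₁ ++ X₂ →
    DownClosed⊛ X₁ → DownClosed⊛ X₂ → DownClosed⊛ L
  DownClosed⊛-union {X₁} X₁⊆L X₂⊆L L⊆X down₁ down₂ {q} q∈L p p⊑q =
    [ (λ q∈X₁ → Any-resp-⊆ X₁⊆L (down₁ {q} q∈X₁ p p⊑q))
    , (λ q∈X₂ → Any-resp-⊆ X₂⊆L (down₂ {q} q∈X₂ p p⊑q))
    ]′ (Any.++⁻ X₁ (Any-resp-⊆ L⊆X q∈L))

  Config⊛-union : ∀ {X₁ X₂ L} → X₁ ⊆ L → X₂ ⊆ L → L ⊆ X₁ ++ X₂ →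
    Config⊛ X₁ → Config⊛ X₂ → Con A (Π₁ L) → Con B (Π₂ L) → ¬ ¬ Config⊛ L
  Config⊛-union {L = L} X₁⊆L X₂⊆L L⊆X
                H₁@((z₁ , z₁⇔ , F₁) , down₁) H₂@((z₂ , z₂⇔ , F₂) , down₂) conA conB = do
    z₁⊆tops ← ⋃⊆tops H₁
    z₂⊆tops ← ⋃⊆tops H₂
    ∈z₁? ← ¬¬-decidableOn z₂
    pure (union ([ map⁺ Ev.top X₁⊆L ∘ z₁⊆tops , map⁺ Ev.top X₂⊆L ∘ z₂⊆tops ]′ ∘ ∈-++⁻ z₁) ∈z₁?)
    where
    union : z₁ ++ z₂ ⊆ map Ev.top L → DecidableOn z₂ (_∈ z₁) → Config⊛ L
    union z⊆tops ∈z₁? =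
      (z₁ ++ z₂ , Enumerates-union X₁⊆L X₂⊆L L⊆X z₁⇔ z₂⇔ , 𝓕-++ F₁ F₂ conA' conB' ∈z₁?) ,
      -- eta-expanded because the implicit event of DownClosed⊛ cannot be inferred
      λ {q} → DownClosed⊛-union X₁⊆L X₂⊆L L⊆X (λ {r} → down₁ {r}) (λ {r} → down₂ {r}) {q}
      where
      conA' = Con-sub A (subst (_ ⊆_) (sym (map-∘ L)) (map⁺ proj₁ z⊆tops)) conA
      conB' = Con-sub B (subst (_ ⊆_) (sym (map-∘ L)) (map⁺ proj₂ z⊆tops)) conB

lemma4 : {A B C : EventStructure} (f : Map A C) (g : Map B C) →
    let open Pullback f g in
    (x : List Ev) → Config⊛ x →
    (p p' : Ev) →
    ¬ (p ∈ₑ x) → ¬ (p' ∈ₑ x) →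
    Config⊛ (p ∷ x) → Config⊛ (p' ∷ x) → ¬ Config⊛ (p ∷ p' ∷ x) →
    ¬ ¬ ((¬ Config A (proj₁ (Ev.top p) ∷ proj₁ (Ev.top p') ∷ Π₁ x))
         ⊎ (¬ Config B (proj₂ (Ev.top p) ∷ proj₂ (Ev.top p') ∷ Π₂ x)))
lemma4 f g x _ p p' _ _ config₁ config₂ ¬config neither =
  neither (inj₁ λ cA → neither (inj₂ λ cB →
    Config⊛-union f g (∷⁺ʳ p (xs⊆x∷xs x p')) (xs⊆x∷xs (p' ∷ x) p) ⊆++
                  config₁ config₂ (proj₁ cA) (proj₁ cB) ¬config))
  where
  ⊆++ : p ∷ p' ∷ x ⊆ (p ∷ x) ++ (p' ∷ x)
  ⊆++ (here refl)         = here refl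
  ⊆++ (there (here refl)) = ∈-++⁺ʳ (p ∷ x) (here refl)
  ⊆++ (there (there q∈x)) = there (∈-++⁺ˡ q∈x)
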